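{- Let $m \geqslant 2$ and $r \geqslant 4$, and let $\mathcal{A}$ be a multi-family of subsets of $[m]$ such that every element of $[m]$ lies in at least two members of $\mathcal{A}$ and $|\mathcal{A}| \leqslant r$. Then the number of unordered pairs $\{A,B\}$ of distinct members of $\mathcal{A}$ (copies of the same set counted as distinct members) with $A \cap B \neq \emptyset$ is at most $$\lambda(r)\Big(\sum_{A\in\mathcal{A}} |A| - 2m\Big) + m, \qquad\text{where } \lambda(r) = \frac{\binom r2 - 2}{r-2}.$$ -}

module Defs where

open import Data.Nat using (ℕ; zero; suc; _+_; _<_)
open import Data.Fin using (Fin; toℕ)
open import Data.Fin.Subset using (Subset; _∩_; _∈_; Nonempty; ∣_∣)
open import Data.Fin.Subset.Properties using (nonempty?)
open import Data.List using (List; length; filter; map)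
open import Data.Nat.ListAction using (sum)
open import Data.List.Relation.Unary.Any using (Any)
open import Data.Product using (_×_; _,_; proj₁; proj₂)
open import Data.Fin.Properties using (_<?_)
open import Relation.Nullary using (Dec)
open import Relation.Nullary.Decidable using (_×-dec_)
open import Data.List using (allFin; cartesianProduct)

-- A multi-family of k subsets of [m] = Fin m, indexed by Fin k
-- (repeated sets allowed; members are distinguished by their index).
Family : ℕ → ℕ → Set
Family m k = Fin k → Subset m

degree : ∀ {m k} → Family m k → Fin m → ℕ
degree {k = k} 𝒜 x = length (filter (λ i → x ∈? 𝒜 i) (allFin k))
  where
  open import Data.Fin.Subset.Properties using (_∈?_)

totalSize : ∀ {m k} → Family m k → ℕ
totalSize {k = k} 𝒜 = sum (map (λ i → ∣ 𝒜 i ∣) (allFin k))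

intersectingPairs : ∀ {m k} → Family m k → ℕ
intersectingPairs {k = k} 𝒜 =
  length (filter (λ p → (proj₁ p <? proj₂ p) ×-dec nonempty? (𝒜 (proj₁ p) ∩ 𝒜 (proj₂ p)))
                 (cartesianProduct (allFin k) (allFin k)))

module Submission where

-- Write P for the number of intersecting pairs, d(x) for the degree of x,
-- c = C(r,2) and D = r - 2, so that the claim reads
--   D·P ≤ (c - 2)·Σₓ (d(x) - 2) + D·m.
-- Two double-counting bounds on P are established first:
--   P ≤ C(k,2) ≤ c                (at most one pair per pair of indices), and
--   P ≤ Σₓ C(d(x),2)              (each intersecting pair has a common element x,
--                                  and C(d(x),2) pairs of members pass through x).  The numerical argument then splits:
-- if some d(x) ≥ r, the excess Σ (d - 2) is at least D and the first bound
-- suffices; otherwise every 2 ≤ d(x) ≤ r - 1, and the convexity of C(d,2) gives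
-- the chord bound D·C(d,2) ≤ (c - 2)(d - 2) + D, which is summed over x.
-- Everything is proved over ℕ (module InNaturals); the integer statement lemma13
-- follows because every subtraction in it is non-truncating.

module InNaturals where
  open import Data.Nat hiding (_<?_)
  open import Data.Nat.Properties hiding (_<?_)
  open import Data.Nat.Tactic.RingSolver using (solve-∀)
  open import Data.Nat.Combinatorics using (_C_; nC1≡n; nCk+nC[k+1]≡[n+1]C[k+1])
  import Data.Nat.ListAction as List
  open import Data.Bool using (true; false; if_then_else_)
  open import Data.Fin as Fin using (Fin; zero; suc)
  open import Data.Fin.Properties using (_<?_; any?)
  open import Data.Fin.Subset using (Subset; _∩_; ∣_∣; Nonempty)
  open import Data.Fin.Subset.Properties using (_∈?_; nonempty?; x∈p∩q⁻)
  open import Data.List using (List; length; filter; map; tabulate; allFin; cartesianProduct; _++_)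
  open import Data.Vec using ([]; _∷_)
  open import Data.List.Properties using (filter-++; length-++; map-tabulate)
  open import Data.Product using (_×_; _,_; proj₁; proj₂)
  open import Function using (_∘_; id)
  open import Relation.Nullary using (Dec; does; _because_; yes; no; contradiction)
  open import Relation.Nullary.Decidable using (_×-dec_)
  open import Relation.Unary using (Decidable)
  open import Relation.Binary.PropositionalEquality
  open import Algebra.Properties.Semiring.Sum +-*-semiring
    using (sum-syntax; sum-cong-≗; ∑-distrib-+; ∑-comm; *-distribˡ-sum)
  open import Defs

  ⟦_⟧ : ∀ {p} {P : Set p} → Dec P → ℕ
  ⟦ p? ⟧ = if does p? then 1 else 0

  ⟦⟧≤1 : ∀ {p} {P : Set p} (d : Dec P) → ⟦ d ⟧ ≤ 1
  ⟦⟧≤1 (true  because _) = ≤-refl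
  ⟦⟧≤1 (false because _) = z≤n

  ⟦⟧-holds : ∀ {p} {P : Set p} (d : Dec P) → P → ⟦ d ⟧ ≡ 1
  ⟦⟧-holds (yes _)  _ = refl
  ⟦⟧-holds (no ¬p) p = contradiction p ¬p

  ⟦×⟧ : ∀ {p q} {P : Set p} {Q : Set q} (p? : Dec P) (q? : Dec Q) →
        ⟦ p? ×-dec q? ⟧ ≡ ⟦ p? ⟧ * ⟦ q? ⟧
  ⟦×⟧ (true  because _) (true  because _) = refl
  ⟦×⟧ (true  because _) (false because _) = refl
  ⟦×⟧ (false because _) _                 = refl

  ∑-mono-≤ : ∀ n {f g : Fin n → ℕ} → (∀ i → f i ≤ g i) → ∑[ i < n ] f i ≤ ∑[ i < n ] g i
  ∑-mono-≤ zero    f≤g = z≤n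
  ∑-mono-≤ (suc n) f≤g = +-mono-≤ (f≤g zero) (∑-mono-≤ n (f≤g ∘ suc))

  term≤∑ : ∀ {n} (f : Fin n → ℕ) i → f i ≤ ∑[ j < n ] f j
  term≤∑ f zero    = m≤m+n (f zero) _
  term≤∑ f (suc i) = ≤-trans (term≤∑ (f ∘ suc) i) (m≤n+m _ (f zero))

  ∑-const : ∀ n c → ∑[ i < n ] c ≡ c * n
  ∑-const zero    c = sym (*-zeroʳ c)
  ∑-const (suc n) c = trans (cong (c +_) (∑-const n c)) (sym (*-suc c n))

  ∑-∸ : ∀ n c (f : Fin n → ℕ) → (∀ i → c ≤ f i) → ∑[ i < n ] f i ≡ ∑[ i < n ] (f i ∸ c) + c * n
  ∑-∸ n c f c≤f = begin
    ∑[ i < n ] f i                        ≡⟨ sum-cong-≗ (λ i → sym (m∸n+n≡m (c≤f i))) ⟩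
    ∑[ i < n ] (f i ∸ c + c)              ≡⟨ ∑-distrib-+ (λ i → f i ∸ c) (λ _ → c) ⟩
    ∑[ i < n ] (f i ∸ c) + ∑[ i < n ] c   ≡⟨ cong (∑[ i < n ] (f i ∸ c) +_) (∑-const n c) ⟩
    ∑[ i < n ] (f i ∸ c) + c * n          ∎
    where open ≡-Reasoning

  sum-tabulate : ∀ {n} (f : Fin n → ℕ) → List.sum (tabulate f) ≡ ∑[ i < n ] f i
  sum-tabulate {zero}  f = refl
  sum-tabulate {suc n} f = cong (f zero +_) (sum-tabulate (f ∘ suc))

  module _ {a p} {A : Set a} {P : A → Set p} (P? : Decidable P) where
    length-filter-tabulate : ∀ {n} (f : Fin n → A) →
                             length (filter P? (tabulate f)) ≡ ∑[ i < n ] ⟦ P? (f i) ⟧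
    length-filter-tabulate {zero}  f = refl
    length-filter-tabulate {suc n} f with P? (f zero)
    ... | true  because _ = cong suc (length-filter-tabulate (f ∘ suc))
    ... | false because _ = length-filter-tabulate (f ∘ suc)

  module _ {a b p} {A : Set a} {B : Set b} {P : A × B → Set p} (P? : Decidable P) where
    length-filter-cartesianProduct :
      ∀ {k l} (f : Fin k → A) (g : Fin l → B) →
      length (filter P? (cartesianProduct (tabulate f) (tabulate g)))
        ≡ ∑[ i < k ] ∑[ j < l ] ⟦ P? (f i , g j) ⟧
    length-filter-cartesianProduct {zero}  f g = refl
    length-filter-cartesianProduct {suc k} {l} f g = begin
      length (filter P? (row ++ rest))                ≡⟨ cong length (filter-++ P? row rest) ⟩
      length (filter P? row ++ filter P? rest)        ≡⟨ length-++ (filter P? row) ⟩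
      length (filter P? row) + length (filter P? rest)
        ≡⟨ cong₂ _+_ (trans (cong (length ∘ filter P?) (map-tabulate g (f zero ,_)))
                            (length-filter-tabulate P? (λ j → f zero , g j)))
                     (length-filter-cartesianProduct (f ∘ suc) g) ⟩
      ∑[ j < l ] ⟦ P? (f zero , g j) ⟧ + ∑[ i < k ] ∑[ j < l ] ⟦ P? (f (suc i) , g j) ⟧ ∎
      where
      open ≡-Reasoning
      row : List (A × B)
      row = map (f zero ,_) (tabulate g)
      rest : List (A × B)
      rest = cartesianProduct (tabulate (f ∘ suc)) (tabulate g)

  ∣p∣≡∑∈ : ∀ {m} (p : Subset m) → ∣ p ∣ ≡ ∑[ x < m ] ⟦ x ∈? p ⟧
  ∣p∣≡∑∈ []          = refl
  ∣p∣≡∑∈ (true  ∷ p) = cong suc (∣p∣≡∑∈ p)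
  ∣p∣≡∑∈ (false ∷ p) = ∣p∣≡∑∈ p

  -- A nonempty intersection contains a common element, which contributes 1·1 to the sum.
  ⟦nonempty∩⟧≤∑ : ∀ {m} (p q : Subset m) →
                  ⟦ nonempty? (p ∩ q) ⟧ ≤ ∑[ x < m ] (⟦ x ∈? p ⟧ * ⟦ x ∈? q ⟧)
  ⟦nonempty∩⟧≤∑ p q with nonempty? (p ∩ q)
  ... | no _               = z≤n
  ... | yes (x , x∈p∩q) with x∈p∩q⁻ p q x∈p∩q
  ...   | x∈p , x∈q = subst (_≤ ∑[ y < _ ] (⟦ y ∈? p ⟧ * ⟦ y ∈? q ⟧))
                            (cong₂ _*_ (⟦⟧-holds (x ∈? p) x∈p) (⟦⟧-holds (x ∈? q) x∈q))
                            (term≤∑ (λ y → ⟦ y ∈? p ⟧ * ⟦ y ∈? q ⟧) x)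

  C2-suc : ∀ n → suc n C 2 ≡ n + n C 2
  C2-suc n = begin
    suc n C 2     ≡⟨ nCk+nC[k+1]≡[n+1]C[k+1] n 1 ⟨
    n C 1 + n C 2 ≡⟨ cong (_+ n C 2) (nC1≡n n) ⟩
    n + n C 2     ∎
    where open ≡-Reasoning

  C2-mono : ∀ {k r} → k ≤ r → k C 2 ≤ r C 2
  C2-mono z≤n                 = z≤n
  C2-mono {suc k} {suc r} (s≤s k≤r) =
    subst₂ _≤_ (sym (C2-suc k)) (sym (C2-suc r)) (+-mono-≤ k≤r (C2-mono k≤r))

  2≤C2 : ∀ {r} → 3 ≤ r → 2 ≤ r C 2
  2≤C2 3≤r = ≤-trans (n≤1+n 2) (C2-mono 3≤r)

  double-C2 : ∀ n → 2 * (suc n C 2) ≡ suc n * n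
  double-C2 zero    = refl
  double-C2 (suc n) = begin
    2 * (suc (suc n) C 2)       ≡⟨ cong (2 *_) (C2-suc (suc n)) ⟩
    2 * (suc n + suc n C 2)     ≡⟨ *-distribˡ-+ 2 (suc n) (suc n C 2) ⟩
    2 * suc n + 2 * (suc n C 2) ≡⟨ cong (2 * suc n +_) (double-C2 n) ⟩
    2 * suc n + suc n * n       ≡⟨ expand n ⟩
    suc (suc n) * suc n         ∎
    where
    open ≡-Reasoning
    expand : ∀ n → 2 * suc n + suc n * n ≡ suc (suc n) * suc n
    expand = solve-∀

  C2-add : ∀ {b} T → b ≤ 1 → b * T + T C 2 ≡ (b + T) C 2
  C2-add T z≤n       = refl
  C2-add T (s≤s z≤n) = trans (cong (_+ T C 2) (*-identityˡ T)) (sym (C2-suc T))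

  ∑-ordered-pairs : ∀ n (b : Fin n → ℕ) → (∀ i → b i ≤ 1) →
    ∑[ i < n ] ∑[ j < n ] (⟦ i <? j ⟧ * (b i * b j)) ≡ (∑[ i < n ] b i) C 2
  ∑-ordered-pairs zero    b b≤1 = refl
  ∑-ordered-pairs (suc n) b b≤1 = begin
    ∑[ j < n ] (1 * (b zero * b (suc j)))
      + ∑[ i < n ] ∑[ j < n ] (⟦ i <? j ⟧ * (b (suc i) * b (suc j)))
        ≡⟨ cong₂ _+_ first-row (∑-ordered-pairs n (b ∘ suc) (b≤1 ∘ suc)) ⟩
    b zero * T + T C 2 ≡⟨ C2-add T (b≤1 zero) ⟩
    (b zero + T) C 2   ∎
    where
    open ≡-Reasoning
    T : ℕ
    T = ∑[ j < n ] b (suc j)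
    first-row : ∑[ j < n ] (1 * (b zero * b (suc j))) ≡ b zero * T
    first-row = trans (sum-cong-≗ (λ j → *-identityˡ (b zero * b (suc j))))
                      (sym (*-distribˡ-sum (b zero) (b ∘ suc)))

  module _ {m k : ℕ} (𝒜 : Family m k) where
    degree-as-sum : ∀ x → degree 𝒜 x ≡ ∑[ i < k ] ⟦ x ∈? 𝒜 i ⟧
    degree-as-sum x = length-filter-tabulate (λ i → x ∈? 𝒜 i) id

    totalSize-as-sum : totalSize 𝒜 ≡ ∑[ x < m ] degree 𝒜 x
    totalSize-as-sum = begin
      List.sum (map (λ i → ∣ 𝒜 i ∣) (allFin k)) ≡⟨ cong List.sum (map-tabulate id (λ i → ∣ 𝒜 i ∣)) ⟩
      List.sum (tabulate (λ i → ∣ 𝒜 i ∣))        ≡⟨ sum-tabulate (λ i → ∣ 𝒜 i ∣) ⟩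
      ∑[ i < k ] ∣ 𝒜 i ∣                         ≡⟨ sum-cong-≗ (λ i → ∣p∣≡∑∈ (𝒜 i)) ⟩
      ∑[ i < k ] ∑[ x < m ] ⟦ x ∈? 𝒜 i ⟧         ≡⟨ ∑-comm (λ i x → ⟦ x ∈? 𝒜 i ⟧) ⟩
      ∑[ x < m ] ∑[ i < k ] ⟦ x ∈? 𝒜 i ⟧         ≡⟨ sum-cong-≗ (λ x → sym (degree-as-sum x)) ⟩
      ∑[ x < m ] degree 𝒜 x                      ∎
      where open ≡-Reasoning

    totalSize≡excess+2m : (∀ x → 2 ≤ degree 𝒜 x) →
                          totalSize 𝒜 ≡ ∑[ x < m ] (degree 𝒜 x ∸ 2) + 2 * m
    totalSize≡excess+2m 2≤deg = trans totalSize-as-sum (∑-∸ m 2 (degree 𝒜) 2≤deg)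

    2m≤totalSize : (∀ x → 2 ≤ degree 𝒜 x) → 2 * m ≤ totalSize 𝒜
    2m≤totalSize 2≤deg = subst (2 * m ≤_) (sym (totalSize≡excess+2m 2≤deg))
                               (m≤n+m (2 * m) (∑[ x < m ] (degree 𝒜 x ∸ 2)))

    pairs-as-sum : intersectingPairs 𝒜 ≡
                   ∑[ i < k ] ∑[ j < k ] (⟦ i <? j ⟧ * ⟦ nonempty? (𝒜 i ∩ 𝒜 j) ⟧)
    pairs-as-sum =
      trans (length-filter-cartesianProduct intersects? id id)
            (sum-cong-≗ λ i → sum-cong-≗ λ j → ⟦×⟧ (i <? j) (nonempty? (𝒜 i ∩ 𝒜 j)))
      where
      intersects? : (p : Fin k × Fin k) →
                    Dec (proj₁ p Fin.< proj₂ p × Nonempty (𝒜 (proj₁ p) ∩ 𝒜 (proj₂ p)))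
      intersects? p = (proj₁ p <? proj₂ p) ×-dec nonempty? (𝒜 (proj₁ p) ∩ 𝒜 (proj₂ p))

    pairs≤C[k,2] : intersectingPairs 𝒜 ≤ k C 2
    pairs≤C[k,2] = begin
      intersectingPairs 𝒜
        ≡⟨ pairs-as-sum ⟩
      ∑[ i < k ] ∑[ j < k ] (⟦ i <? j ⟧ * ⟦ nonempty? (𝒜 i ∩ 𝒜 j) ⟧)
        ≤⟨ ∑-mono-≤ k (λ i → ∑-mono-≤ k (λ j →
             *-monoʳ-≤ ⟦ i <? j ⟧ (⟦⟧≤1 (nonempty? (𝒜 i ∩ 𝒜 j))))) ⟩
      ∑[ i < k ] ∑[ j < k ] (⟦ i <? j ⟧ * (1 * 1))
        ≡⟨ ∑-ordered-pairs k (λ _ → 1) (λ _ → ≤-refl) ⟩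
      (∑[ i < k ] 1) C 2
        ≡⟨ cong (_C 2) (trans (∑-const k 1) (*-identityˡ k)) ⟩
      k C 2 ∎
      where open ≤-Reasoning

    -- Each intersecting pair has a common element x, and C(d(x),2) pairs pass through x.
    pairs≤∑C[deg,2] : intersectingPairs 𝒜 ≤ ∑[ x < m ] (degree 𝒜 x C 2)
    pairs≤∑C[deg,2] = begin
      intersectingPairs 𝒜
        ≡⟨ pairs-as-sum ⟩
      ∑[ i < k ] ∑[ j < k ] (⟦ i <? j ⟧ * ⟦ nonempty? (𝒜 i ∩ 𝒜 j) ⟧)
        ≤⟨ ∑-mono-≤ k (λ i → ∑-mono-≤ k (λ j → *-monoʳ-≤ ⟦ i <? j ⟧ (⟦nonempty∩⟧≤∑ (𝒜 i) (𝒜 j)))) ⟩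
      ∑[ i < k ] ∑[ j < k ] (⟦ i <? j ⟧ * ∑[ x < m ] (a x i * a x j))
        ≡⟨ sum-cong-≗ (λ i → sum-cong-≗ (λ j → *-distribˡ-sum ⟦ i <? j ⟧ (λ x → a x i * a x j))) ⟩
      ∑[ i < k ] ∑[ j < k ] ∑[ x < m ] F x i j
        ≡⟨ sum-cong-≗ (λ i → ∑-comm (λ j x → F x i j)) ⟩
      ∑[ i < k ] ∑[ x < m ] ∑[ j < k ] F x i j
        ≡⟨ ∑-comm (λ i x → ∑[ j < k ] F x i j) ⟩
      ∑[ x < m ] ∑[ i < k ] ∑[ j < k ] F x i j
        ≡⟨ sum-cong-≗ (λ x → ∑-ordered-pairs k (a x) (λ i → ⟦⟧≤1 (x ∈? 𝒜 i))) ⟩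
      ∑[ x < m ] ((∑[ i < k ] a x i) C 2)
        ≡⟨ sum-cong-≗ (λ x → cong (_C 2) (sym (degree-as-sum x))) ⟩
      ∑[ x < m ] (degree 𝒜 x C 2) ∎
      where
      open ≤-Reasoning
      a : Fin m → Fin k → ℕ
      a x i = ⟦ x ∈? 𝒜 i ⟧
      F : Fin m → Fin k → Fin k → ℕ
      F x i j = ⟦ i <? j ⟧ * (a x i * a x j)

  -- Throughout, r = D + 2 with D ≥ 2; c = C(r,2) and L = c - 2 is the numerator of λ(r).
  module _ (D : ℕ) (2≤D : 2 ≤ D) where
    c : ℕ
    c = (2 + D) C 2

    L : ℕ
    L = c ∸ 2

    2≤c : 2 ≤ c
    2≤c = 2≤C2 (+-monoʳ-≤ 2 (≤-trans (n≤1+n 1) 2≤D))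

    -- After doubling, both sides
    -- differ by e·(D·e + 2) versus e·D², and D·e + 2 ≤ D·(e + 1) ≤ D².
    convexity : ∀ e → e < D → D * ((2 + e) C 2) + 2 * e ≤ c * e + D
    convexity e e<D = *-cancelˡ-≤ 2 (begin
      2 * (D * cₑ + 2 * e)              ≡⟨ double-left D cₑ e ⟩
      D * (2 * cₑ) + 4 * e              ≡⟨ cong (λ z → D * z + 4 * e) (double-C2 (suc e)) ⟩
      D * ((2 + e) * (1 + e)) + 4 * e   ≡⟨ expand-left D e ⟩
      e * (D * e + 2) + rest            ≤⟨ +-monoˡ-≤ rest (*-monoʳ-≤ e De+2≤D²) ⟩
      e * (D * D) + rest                ≡⟨ expand-right D e ⟩
      ((2 + D) * (1 + D)) * e + 2 * D   ≡⟨ cong (λ z → z * e + 2 * D) (double-C2 (suc D)) ⟨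
      (2 * c) * e + 2 * D               ≡⟨ double-right c e D ⟩
      2 * (c * e + D)                   ∎)
      where
      open ≤-Reasoning
      cₑ : ℕ
      cₑ = (2 + e) C 2
      rest : ℕ
      rest = 3 * D * e + 2 * D + 2 * e
      De+2≤D² : D * e + 2 ≤ D * D
      De+2≤D² = begin
        D * e + 2 ≤⟨ +-monoʳ-≤ (D * e) 2≤D ⟩
        D * e + D ≡⟨ trans (+-comm (D * e) D) (sym (*-suc D e)) ⟩
        D * suc e ≤⟨ *-monoʳ-≤ D e<D ⟩
        D * D     ∎
      double-left : ∀ D c e → 2 * (D * c + 2 * e) ≡ D * (2 * c) + 4 * e
      double-left = solve-∀
      expand-left : ∀ D e →
        D * ((2 + e) * (1 + e)) + 4 * e ≡ e * (D * e + 2) + (3 * D * e + 2 * D + 2 * e)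
      expand-left = solve-∀
      expand-right : ∀ D e →
        e * (D * D) + (3 * D * e + 2 * D + 2 * e) ≡ ((2 + D) * (1 + D)) * e + 2 * D
      expand-right = solve-∀
      double-right : ∀ c e D → (2 * c) * e + 2 * D ≡ 2 * (c * e + D)
      double-right = solve-∀

    chord-bound : ∀ {d} → 2 ≤ d → d < 2 + D → D * (d C 2) ≤ L * (d ∸ 2) + D
    chord-bound {suc (suc e)} (s≤s (s≤s z≤n)) (s≤s (s≤s e<D)) =
      +-cancelʳ-≤ (2 * e) _ _ (begin
        D * ((2 + e) C 2) + 2 * e ≤⟨ convexity e e<D ⟩
        c * e + D                 ≡⟨ cong (λ z → z * e + D) (m∸n+n≡m 2≤c) ⟨
        (L + 2) * e + D           ≡⟨ regroup L e D ⟩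
        L * e + D + 2 * e         ∎)
      where
      open ≤-Reasoning
      regroup : ∀ L e D → (L + 2) * e + D ≡ L * e + D + 2 * e
      regroup = solve-∀

    excess-bound : ∀ m (d : Fin m → ℕ) P → 2 ≤ m → (∀ x → 2 ≤ d x) →
                   P ≤ c → P ≤ ∑[ x < m ] (d x C 2) →
                   D * P ≤ L * ∑[ x < m ] (d x ∸ 2) + D * m
    excess-bound m d P 2≤m 2≤d P≤c P≤∑ with any? (λ x → 2 + D ≤? d x)
    ... | yes (x , large) = begin
      D * P         ≤⟨ *-monoʳ-≤ D P≤c ⟩
      D * c         ≡⟨ cong (D *_) (m∸n+n≡m 2≤c) ⟨
      D * (L + 2)   ≡⟨ *-distribˡ-+ D L 2 ⟩
      D * L + D * 2 ≤⟨ +-mono-≤ (≤-trans (≤-reflexive (*-comm D L)) (*-monoʳ-≤ L D≤t))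
                                (*-monoʳ-≤ D 2≤m) ⟩
      L * t + D * m ∎
      where
      -- a single element of degree ≥ D + 2 already makes the excess t at least D
      open ≤-Reasoning
      t : ℕ
      t = ∑[ y < m ] (d y ∸ 2)
      D≤t : D ≤ t
      D≤t = ≤-trans (∸-monoˡ-≤ 2 large) (term≤∑ (λ y → d y ∸ 2) x)
    ... | no no-large = begin
      D * P                                       ≤⟨ *-monoʳ-≤ D P≤∑ ⟩
      D * ∑[ x < m ] (d x C 2)                    ≡⟨ *-distribˡ-sum D (λ x → d x C 2) ⟩
      ∑[ x < m ] (D * (d x C 2))                  ≤⟨ ∑-mono-≤ m chord ⟩
      ∑[ x < m ] (L * (d x ∸ 2) + D)              ≡⟨ ∑-distrib-+ (λ x → L * (d x ∸ 2)) (λ _ → D) ⟩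
      ∑[ x < m ] (L * (d x ∸ 2)) + ∑[ x < m ] D   ≡⟨ cong₂ _+_ (*-distribˡ-sum L (λ x → d x ∸ 2))
                                                               (sym (∑-const m D)) ⟨
      L * ∑[ x < m ] (d x ∸ 2) + D * m            ∎
      where
      -- every degree lies in [2, D + 1], where the chord bound applies
      open ≤-Reasoning
      chord : ∀ x → D * (d x C 2) ≤ L * (d x ∸ 2) + D
      chord x = chord-bound (2≤d x) (≰⇒> (λ large → no-large (x , large)))

  -- The theorem over ℕ; its truncated subtractions are exact by 2≤C2 and 2m≤totalSize.
  intersectingPairs-bound : ∀ m r k → 2 ≤ m → 4 ≤ r → (𝒜 : Family m k) →
    (∀ x → 2 ≤ degree 𝒜 x) → k ≤ r →
    (r ∸ 2) * intersectingPairs 𝒜 ≤ (r C 2 ∸ 2) * (totalSize 𝒜 ∸ 2 * m) + (r ∸ 2) * m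
  intersectingPairs-bound m (suc (suc D)) k 2≤m (s≤s (s≤s 2≤D)) 𝒜 2≤deg k≤r =
    subst (λ t → D * intersectingPairs 𝒜 ≤ L D 2≤D * t + D * m) (sym excess)
      (excess-bound D 2≤D m (degree 𝒜) (intersectingPairs 𝒜) 2≤m 2≤deg
         (≤-trans (pairs≤C[k,2] 𝒜) (C2-mono k≤r)) (pairs≤∑C[deg,2] 𝒜))
    where
    excess : totalSize 𝒜 ∸ 2 * m ≡ ∑[ x < m ] (degree 𝒜 x ∸ 2)
    excess = trans (cong (_∸ 2 * m) (totalSize≡excess+2m 𝒜 2≤deg))
                   (m+n∸n≡m (∑[ x < m ] (degree 𝒜 x ∸ 2)) (2 * m))

open import Defs
open import Data.Nat using (ℕ; _≤_; _∸_) renaming (_*_ to _*ℕ_; _+_ to _+ℕ_)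
open import Data.Nat.Combinatorics using (_C_)
open import Data.Fin using (Fin)
open import Data.Integer using (+_; _-_; _*_; _+_) renaming (_≤_ to _≤ℤ_)
open import Data.Integer.Base using (+≤+)
open import Data.Integer.Properties using (m-n≡m⊖n; ⊖-≥; pos-*; pos-+)
import Data.Nat.Properties as ℕ
open import Relation.Binary.PropositionalEquality using (_≡_; sym; trans)
open InNaturals using (intersectingPairs-bound; 2≤C2; 2m≤totalSize)

exact-subtraction : ∀ {a b} → b ≤ a → + a - + b ≡ + (a ∸ b)
exact-subtraction {a} {b} b≤a = trans (m-n≡m⊖n a b) (⊖-≥ b≤a)

cast-bound : ∀ a b c d e f → a *ℕ b ≤ c *ℕ d +ℕ e *ℕ f → + a * + b ≤ℤ + c * + d + + e * + f
cast-bound a b c d e f le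
  rewrite sym (pos-* a b) | sym (pos-* c d) | sym (pos-* e f) | sym (pos-+ (c *ℕ d) (e *ℕ f))
  = +≤+ le

lemma13 : (m r k : ℕ) → 2 ≤ m → 4 ≤ r → (𝒜 : Family m k) →
          (∀ (x : Fin m) → 2 ≤ degree 𝒜 x) → k ≤ r →
          (+ r - + 2) * + intersectingPairs 𝒜
            ≤ℤ (+ (r C 2) - + 2) * (+ totalSize 𝒜 - + (2 *ℕ m)) + (+ r - + 2) * + m
lemma13 m r k 2≤m 4≤r 𝒜 2≤deg k≤r
  rewrite exact-subtraction (ℕ.≤-trans (ℕ.m≤n+m 2 2) 4≤r)
        | exact-subtraction (2≤C2 (ℕ.≤-trans (ℕ.n≤1+n 3) 4≤r))
        | exact-subtraction (2m≤totalSize 𝒜 2≤deg)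
  = cast-bound (r ∸ 2) (intersectingPairs 𝒜) (r C 2 ∸ 2) (totalSize 𝒜 ∸ 2 *ℕ m) (r ∸ 2) m
               (intersectingPairs-bound m r k 2≤m 4≤r 𝒜 2≤deg k≤r)
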